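{- Let $G=(V,E)$ be a finite simple undirected graph with $n=|V|$. Let $G_0:=G$ and let $W_1,\dots,W_r$ be distinct subsets of $V$ such that for every $t\in\{1,\dots,r\}$, $W_t$ is a clique of $G_{t-1}$ with $|W_t|\ge2$ and $G_t:=G_{t-1}\mid W_t$. Let $F_0:=STAB(G)$, $F_t:=\{x\in STAB(G)\mid x_{W_j}=1,\ j=1,\dots,t\}$, and $\mathcal S_t:=F_t\cap\{0,1\}^V$ for $t\in\{0,\dots,r\}$. Let $c^\top x\le d$, with $c\in\mathbb{R}^n$, $d\in\mathbb{R}$, be a valid inequality for $STAB(G_r)$. For $t\in\{0,\dots,r\}$ define $$f_t(x)=c^\top x+\sum_{\ell=t+1}^r\lambda^S_\ell(x_{W_\ell}-1),$$ where, for $\ell=r,r-1,\dots,1$, $$\lambda^S_\ell=\max\{f_\ell(x)-d\mid x\in\mathcal S_{\ell-1},\ x_{W_\ell}=0\},$$ with the convention $\max\emptyset=0$. Then $f_t(x)\le d$ is valid for $F_t$, for every $t\in\{0,\dots,r\}$.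
   Context: For a graph $H$ on vertex set $V$, $STAB(H)\subseteq\mathbb{R}^V$ is the convex hull of the characteristic vectors of the stable sets of $H$. For $x\in\mathbb{R}^V$ and $W\subseteq V$, $x_W=\sum_{v\in W}x_v$. For a graph $H=(V,E_H)$ and a clique $W$ of $H$ with $|W|\ge2$, the clique projection is $H\mid W=(V,E_H\cup\{uv\notin E_H\mid u\ne v,\ W\subseteq N_H(u)\cup N_H(v)\})$, where $N_H(u)$ is the neighborhood of $u$ in $H$. -}

module Defs where

open import Level using (Level; _⊔_; suc)
open import Data.Nat as ℕ using (ℕ; zero; _∸_)
open import Data.Fin using (Fin; zero; _≟_)
import Data.Fin as Fin
open import Data.Fin.Subset using (Subset; _∈_; _∪_; ∣_∣)
open import Data.Fin.Subset.Properties using (_⊆?_)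
open import Data.Bool using (Bool; true; false; _∨_; _∧_; not; if_then_else_)
open import Data.Vec using (lookup; tabulate)
open import Data.List using (List; []; _∷_)
open import Data.List.Relation.Unary.All using (All)
open import Data.Product using (_×_; _,_; ∃; Σ)
open import Data.Sum using (_⊎_)
open import Relation.Nullary using (¬_; does)
open import Relation.Binary.PropositionalEquality using (_≡_; _≢_)
open import Algebra.Structures using (IsCommutativeRing)
open import Relation.Binary.Structures using (IsTotalOrder)

-- Ordered fields (the paper works over ℝ; we state the result for an
-- arbitrary ordered field, ℝ being one instance).

record OrderedField (a ℓ₁ ℓ₂ : Level) : Set (Level.suc (a ⊔ ℓ₁ ⊔ ℓ₂)) where
  infix  4 _≈_ _≤_
  infixl 7 _*_
  infixl 6 _+_
  infix  8 -_
  field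
    Carrier : Set a
    _≈_     : Carrier → Carrier → Set ℓ₁
    _≤_     : Carrier → Carrier → Set ℓ₂
    _+_     : Carrier → Carrier → Carrier
    _*_     : Carrier → Carrier → Carrier
    -_      : Carrier → Carrier
    0#      : Carrier
    1#      : Carrier
    isCommutativeRing : IsCommutativeRing _≈_ _+_ _*_ -_ 0# 1#
    isTotalOrder      : IsTotalOrder _≈_ _≤_
    0≉1     : ¬ (0# ≈ 1#)
    inverse : ∀ x → ¬ (x ≈ 0#) → ∃ λ y → x * y ≈ 1#
    +-mono-≤ : ∀ {x y} z → x ≤ y → x + z ≤ y + z
    *-nonneg : ∀ {x y} → 0# ≤ x → 0# ≤ y → 0# ≤ x * y

  _-_ : Carrier → Carrier → Carrier
  x - y = x + (- y)

Graph : ℕ → Set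
Graph n = Fin n → Fin n → Bool

Simple : ∀ {n} → Graph n → Set
Simple {n} G = (∀ u v → G u v ≡ G v u) × (∀ u → G u u ≡ false)

N : ∀ {n} → Graph n → Fin n → Subset n
N H u = tabulate (H u)

IsClique : ∀ {n} → Graph n → Subset n → Set
IsClique H W = ∀ u v → u ∈ W → v ∈ W → u ≢ v → H u v ≡ true

IsStable : ∀ {n} → Graph n → Subset n → Set
IsStable H S = ∀ u v → u ∈ S → v ∈ S → H u v ≡ false

_∣proj_ : ∀ {n} → Graph n → Subset n → Graph n
(H ∣proj W) u v = H u v ∨ (not (does (u ≟ v)) ∧ does (W ⊆? (N H u ∪ N H v)))

-- G_0 = G, G_t = G_{t-1} | W_t  (W indexed by 1..r; W 0 unused)
Gseq : ∀ {n} → Graph n → (ℕ → Subset n) → ℕ → Graph n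
Gseq G W zero      = G
Gseq G W (ℕ.suc t) = Gseq G W t ∣proj W (ℕ.suc t)

module OF {a ℓ₁ ℓ₂} (K : OrderedField a ℓ₁ ℓ₂) where
  open OrderedField K public

  sumFin : ∀ {n} → (Fin n → Carrier) → Carrier
  sumFin {zero}    f = 0#
  sumFin {ℕ.suc n} f = f zero + sumFin (λ v → f (Fin.suc v))

  sumN : ℕ → (ℕ → Carrier) → Carrier
  sumN zero      g = 0#
  sumN (ℕ.suc k) g = sumN k g + g k

  -- Σ_{ℓ = t+1}^{r} g ℓ
  sumRange : ℕ → ℕ → (ℕ → Carrier) → Carrier
  sumRange t r g = sumN (r ∸ t) (λ i → g (t ℕ.+ ℕ.suc i))

  dot : ∀ {n} → (Fin n → Carrier) → (Fin n → Carrier) → Carrier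
  dot c x = sumFin (λ v → c v * x v)

  xW : ∀ {n} → (Fin n → Carrier) → Subset n → Carrier
  xW x W = sumFin (λ v → if lookup W v then x v else 0#)

  χ : ∀ {n} → Subset n → Fin n → Carrier
  χ S v = if lookup S v then 1# else 0#

  sumCoeff : ∀ {n} → List (Carrier × Subset n) → Carrier
  sumCoeff []             = 0#
  sumCoeff ((μ , _) ∷ ms) = μ + sumCoeff ms

  combAt : ∀ {n} → List (Carrier × Subset n) → Fin n → Carrier
  combAt []             v = 0#
  combAt ((μ , S) ∷ ms) v = μ * χ S v + combAt ms v

  STAB : ∀ {n} → Graph n → (Fin n → Carrier) → Set (a ⊔ ℓ₁ ⊔ ℓ₂)
  STAB H x = Σ (List (Carrier × Subset _)) λ ms →
      All (λ p → (0# ≤ Data.Product.proj₁ p) × IsStable H (Data.Product.proj₂ p)) ms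
    × (sumCoeff ms ≈ 1#)
    × (∀ v → x v ≈ combAt ms v)

  Fset : ∀ {n} → Graph n → (ℕ → Subset n) → ℕ → (Fin n → Carrier) → Set (a ⊔ ℓ₁ ⊔ ℓ₂)
  Fset G W t x = STAB G x × (∀ j → 1 ℕ.≤ j → j ℕ.≤ t → xW x (W j) ≈ 1#)

  -- S_t = F_t ∩ {0,1}^V, a 0/1 vector being the characteristic vector of b
  Sset : ∀ {n} → Graph n → (ℕ → Subset n) → ℕ → Subset n → Set (a ⊔ ℓ₁ ⊔ ℓ₂)
  Sset G W t b = Fset G W t (χ b)

  fval : ∀ {n} → (ℕ → Subset n) → ℕ → (Fin n → Carrier) → (ℕ → Carrier)
       → ℕ → (Fin n → Carrier) → Carrier
  fval W r c λS t x = dot c x + sumRange t r (λ ℓ → λS ℓ * (xW x (W ℓ) - 1#))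

  IsMaxOr0 : ∀ {n} {p} → (Subset n → Set p) → (Subset n → Carrier) → Carrier
           → Set (ℓ₁ ⊔ ℓ₂ ⊔ p)
  IsMaxOr0 P g m =
      ((∃ λ b → P b × (m ≈ g b)) × (∀ b → P b → g b ≤ m))
    ⊎ ((∀ b → ¬ P b) × (m ≈ 0#))

-- Downward induction on t, first for vertices of F_t. A stable set S of G meeting each of
-- W_1, …, W_t in exactly one vertex stays stable in G_t, because every edge uv added by a clique
-- projection H | W needs W ⊆ N(u) ∪ N(v), which fails once a vertex of S lies in W. As W_{t+1}
-- is a clique of G_t, such an S meets W_{t+1} at most once: if once, f_t(χ_S) = f_{t+1}(χ_S) ≤ d
-- by induction; if never, f_t(χ_S) = f_{t+1}(χ_S) − λ_{t+1} ≤ d by the choice of λ_{t+1}; and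
-- f_r = cᵀx is valid for STAB(G_r). A point x ∈ F_t is a convex combination Σ μ_S χ_S of stable
-- sets of G; comparing Σ μ_S |S ∩ W_j| = x_{W_j} = 1 = Σ μ_S term by term shows that every S of
-- positive weight meets every W_j once, and f_t is affine.

module Submission where

open import Level using (_⊔_)
open import Defs
open import Data.Nat using (ℕ; zero; suc; _∸_; z≤n; s≤s) renaming (_+_ to _+ℕ_; _≤_ to _≤ℕ_; _<_ to _<ℕ_)
import Data.Nat.Properties as ℕ
open import Data.Fin using (Fin; _≟_)
import Data.Fin as Fin
open import Data.Fin.Subset using (Subset; _∈_; _∩_; _∪_; _⊆_; ∣_∣; ⁅_⁆; Nonempty)
open import Data.Fin.Subset.Properties
  using (_⊆?_; nonempty?; Empty-unique; ∣⊥∣≡0; p⊆q⇒∣p∣≤∣q∣; x∈⁅x⁆; ∣⁅x⁆∣≡1; x∈p∩q⁻; x∈p∪q⁻)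
open import Data.Bool using (true; false; if_then_else_)
open import Data.Bool.Properties using (∧-zeroʳ)
open import Data.Vec using (lookup; []; _∷_)
open import Data.Vec.Properties using ([]=⇒lookup; lookup∘tabulate)
open import Data.Product using (_×_; _,_; proj₁; proj₂)
open import Data.Sum using (_⊎_; inj₁; inj₂)
open import Relation.Nullary using (¬_; yes; no; contradiction)
open import Relation.Nullary.Decidable using (dec-false)
open import Relation.Binary.PropositionalEquality using (_≡_; _≢_; refl; sym; trans; cong; cong₂; subst)
open import Data.List using (List; []; _∷_)
open import Data.List.Relation.Unary.All using (All; []; _∷_)
import Data.List.Relation.Unary.All as All
open import Algebra.Bundles using (CommutativeRing)
open import Relation.Binary.Bundles using (Poset)
open import Relation.Binary.Structures using (IsTotalOrder)

private
  variable
    n : ℕ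
    H : Graph n
    S W : Subset n

∣p∣≡1⇒Nonempty : (p : Subset n) → ∣ p ∣ ≡ 1 → Nonempty p
∣p∣≡1⇒Nonempty {n} p ∣p∣≡1 with nonempty? p
... | yes ne    = ne
... | no  empty = contradiction (trans (sym ∣p∣≡1) (trans (cong ∣_∣ (Empty-unique empty)) (∣⊥∣≡0 n))) λ ()

subsingleton⇒∣p∣≤1 : (p : Subset n) → (∀ {u v} → u ∈ p → v ∈ p → u ≡ v) → ∣ p ∣ ≤ℕ 1
subsingleton⇒∣p∣≤1 {n} p unique with nonempty? p
... | yes (x , x∈p) = ℕ.≤-trans (p⊆q⇒∣p∣≤∣q∣ p⊆⁅x⁆) (ℕ.≤-reflexive (∣⁅x⁆∣≡1 x))
  where
  p⊆⁅x⁆ : p ⊆ ⁅ x ⁆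
  p⊆⁅x⁆ y∈p = subst (_∈ ⁅ x ⁆) (unique x∈p y∈p) (x∈⁅x⁆ x)
... | no empty = ℕ.≤-trans (ℕ.≤-reflexive (trans (cong ∣_∣ (Empty-unique empty)) (∣⊥∣≡0 n))) z≤n

∣stable∩clique∣≤1 : IsStable H S → IsClique H W → ∣ S ∩ W ∣ ≤ℕ 1
∣stable∩clique∣≤1 {S = S} {W = W} stable clique = subsingleton⇒∣p∣≤1 (S ∩ W) unique
  where
  unique : ∀ {u v} → u ∈ S ∩ W → v ∈ S ∩ W → u ≡ v
  unique {u} {v} u∈S∩W v∈S∩W with x∈p∩q⁻ S W u∈S∩W | x∈p∩q⁻ S W v∈S∩W | u ≟ v
  ... | _ | _ | yes u≡v = u≡v
  ... | u∈S , u∈W | v∈S , v∈W | no u≢v =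
    contradiction (trans (sym (clique u v u∈W v∈W u≢v)) (stable u v u∈S v∈S)) λ ()

∈N⇒adjacent : ∀ {u v} → v ∈ N H u → H u v ≡ true
∈N⇒adjacent {H = H} {u} {v} v∈N = trans (sym (lookup∘tabulate (H u) v)) ([]=⇒lookup v∈N)

stable⇒∉N : IsStable H S → ∀ {u w} → u ∈ S → w ∈ S → ¬ w ∈ N H u
stable⇒∉N {H = H} stable {u} {w} u∈S w∈S w∈Nu =
  contradiction (trans (sym (∈N⇒adjacent {H = H} w∈Nu)) (stable u w u∈S w∈S)) λ ()

stable⇒⊈N∪N : IsStable H S → Nonempty (S ∩ W) → ∀ {u v} → u ∈ S → v ∈ S → ¬ W ⊆ (N H u ∪ N H v)
stable⇒⊈N∪N {H = H} {S = S} {W = W} stable (w , w∈S∩W) {u} {v} u∈S v∈S W⊆N∪N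
  with w∈S , w∈W ← x∈p∩q⁻ S W w∈S∩W
  with x∈p∪q⁻ (N H u) (N H v) (W⊆N∪N w∈W)
... | inj₁ w∈Nu = stable⇒∉N stable u∈S w∈S w∈Nu
... | inj₂ w∈Nv = stable⇒∉N stable v∈S w∈S w∈Nv

stable-∣proj : IsStable H S → Nonempty (S ∩ W) → IsStable (H ∣proj W) S
stable-∣proj {H = H} {S = S} {W = W} stable meets u v u∈S v∈S
  rewrite stable u v u∈S v∈S | dec-false (W ⊆? (N H u ∪ N H v)) (stable⇒⊈N∪N stable meets u∈S v∈S)
  = ∧-zeroʳ _

-- For S stable in G, this says χ_S ∈ 𝒮_t.
MeetsOnce : (ℕ → Subset n) → ℕ → Subset n → Set
MeetsOnce W t S = ∀ j → 1 ≤ℕ j → j ≤ℕ t → ∣ S ∩ W j ∣ ≡ 1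

MeetsOnce-zero : ∀ (W : ℕ → Subset n) S → MeetsOnce W 0 S
MeetsOnce-zero W S j (s≤s _) ()

MeetsOnce-suc : ∀ {W : ℕ → Subset n} {t} → MeetsOnce W t S → ∣ S ∩ W (suc t) ∣ ≡ 1 → MeetsOnce W (suc t) S
MeetsOnce-suc meets meets-next j 1≤j j≤1+t with ℕ.m≤n⇒m<n∨m≡n j≤1+t
... | inj₁ j<1+t = meets j 1≤j (ℕ.≤-pred j<1+t)
... | inj₂ refl  = meets-next

MeetsOnce-pred : ∀ {W : ℕ → Subset n} {t} → MeetsOnce W (suc t) S → MeetsOnce W t S
MeetsOnce-pred meets j 1≤j j≤t = meets j 1≤j (ℕ.m≤n⇒m≤1+n j≤t)

stable-Gseq : ∀ {G : Graph n} {W} t → IsStable G S → MeetsOnce W t S → IsStable (Gseq G W t) S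
stable-Gseq zero    stable meets = stable
stable-Gseq {S = S} {W = W} (suc t) stable meets =
  stable-∣proj (stable-Gseq t stable (MeetsOnce-pred {S = S} meets))
               (∣p∣≡1⇒Nonempty (S ∩ W (suc t)) (meets (suc t) (s≤s z≤n) ℕ.≤-refl))

1+k+t≡r⇒t<r : ∀ {k t r} → suc k +ℕ t ≡ r → t <ℕ r
1+k+t≡r⇒t<r {k} {t} refl = s≤s (ℕ.m≤n+m t k)

module _ {a ℓ₁ ℓ₂} (K : OrderedField a ℓ₁ ℓ₂) where
  open OF K

  commutativeRing : CommutativeRing a ℓ₁
  commutativeRing = record { isCommutativeRing = isCommutativeRing }

  open CommutativeRing commutativeRing
    using ( ring; semiring; *-commutativeSemigroup; +-commutativeSemigroup
          ; +-cong; +-congˡ; +-congʳ; *-congˡ; *-congʳ; +-comm; +-assoc; +-identityˡ; +-identityʳ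
          ; *-comm; *-identityˡ; *-identityʳ; zeroˡ; zeroʳ; distribˡ; -‿cong; -‿inverseʳ; -‿inverseˡ )
    renaming (refl to ≈-refl; sym to ≈-sym; trans to ≈-trans; reflexive to ≈-reflexive)
  open import Algebra.Properties.Ring ring
    using (-1*x≈-x; -‿involutive; -‿distribʳ-*; x[y-z]≈xy-xz; +-cancelʳ; \\-leftDividesʳ; //-rightDividesˡ)
  open import Algebra.Properties.CommutativeSemigroup *-commutativeSemigroup using (x∙yz≈y∙xz)
  open import Algebra.Properties.CommutativeSemigroup +-commutativeSemigroup using (interchange; x∙yz≈xz∙y)
  open import Algebra.Properties.Semiring.Sum semiring
    using (sum; sum-cong-≋; ∑-distrib-+; *-distribˡ-sum; sum-replicate-zero)
  open import Algebra.Definitions.RawMonoid (CommutativeRing.+-rawMonoid commutativeRing)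
    using () renaming (_×_ to _times_)
  open IsTotalOrder isTotalOrder
    using (total; antisym) renaming (refl to ≤-refl; reflexive to ≤-reflexive; trans to ≤-trans)

  poset : Poset a ℓ₁ ℓ₂
  poset = record { isPartialOrder = IsTotalOrder.isPartialOrder isTotalOrder }

  open import Relation.Binary.Reasoning.PartialOrder poset

  0≤1 : 0# ≤ 1#
  0≤1 with total 0# 1#
  ... | inj₁ 0≤1 = 0≤1
  ... | inj₂ 1≤0 = contradiction (antisym 0≤1′ 1≤0) 0≉1
    where
    0≤-1 : 0# ≤ - 1#
    0≤-1 = begin
      0#          ≈⟨ -‿inverseʳ 1# ⟨
      1# + - 1#   ≤⟨ +-mono-≤ (- 1#) 1≤0 ⟩
      0# + - 1#   ≈⟨ +-identityˡ (- 1#) ⟩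
      - 1#        ∎
    0≤1′ : 0# ≤ 1#
    0≤1′ = begin
      0#          ≤⟨ *-nonneg 0≤-1 0≤-1 ⟩
      - 1# * - 1# ≈⟨ -1*x≈-x (- 1#) ⟩
      - (- 1#)    ≈⟨ -‿involutive 1# ⟩
      1#          ∎

  +-monoʳ-≤ : ∀ z {x y} → x ≤ y → z + x ≤ z + y
  +-monoʳ-≤ z {x} {y} x≤y = begin
    z + x ≈⟨ +-comm z x ⟩
    x + z ≤⟨ +-mono-≤ z x≤y ⟩
    y + z ≈⟨ +-comm y z ⟩
    z + y ∎

  +-mono₂-≤ : ∀ {x y u v} → x ≤ y → u ≤ v → x + u ≤ y + v
  +-mono₂-≤ {x} {y} {u} {v} x≤y u≤v = begin
    x + u ≤⟨ +-mono-≤ u x≤y ⟩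
    y + u ≤⟨ +-monoʳ-≤ y u≤v ⟩
    y + v ∎

  x≤y⇒0≤y-x : ∀ {x y} → x ≤ y → 0# ≤ y - x
  x≤y⇒0≤y-x {x} {y} x≤y = begin
    0#    ≈⟨ -‿inverseʳ x ⟨
    x - x ≤⟨ +-mono-≤ (- x) x≤y ⟩
    y - x ∎

  0≤y-x⇒x≤y : ∀ {x y} → 0# ≤ y - x → x ≤ y
  0≤y-x⇒x≤y {x} {y} 0≤y-x = begin
    x              ≈⟨ +-identityˡ x ⟨
    0# + x         ≤⟨ +-mono-≤ x 0≤y-x ⟩
    (y - x) + x    ≈⟨ +-assoc y (- x) x ⟩
    y + (- x + x)  ≈⟨ +-congˡ (-‿inverseˡ x) ⟩
    y + 0#         ≈⟨ +-identityʳ y ⟩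
    y              ∎

  *-monoˡ-≤-nonneg : ∀ {z x y} → 0# ≤ z → x ≤ y → z * x ≤ z * y
  *-monoˡ-≤-nonneg {z} {x} {y} 0≤z x≤y = 0≤y-x⇒x≤y (begin
    0#            ≤⟨ *-nonneg 0≤z (x≤y⇒0≤y-x x≤y) ⟩
    z * (y - x)   ≈⟨ x[y-z]≈xy-xz z y x ⟩
    (z * y) - (z * x) ∎)

  x-z≤y⇒x-y≤z : ∀ {x y z} → x - z ≤ y → x - y ≤ z
  x-z≤y⇒x-y≤z {x} {y} {z} x-z≤y = begin
    x - y                ≈⟨ +-congˡ (\\-leftDividesʳ z (- y)) ⟨
    x + (- z + (z - y))  ≈⟨ +-assoc x (- z) (z - y) ⟨
    (x - z) + (z - y)    ≤⟨ +-mono-≤ (z - y) x-z≤y ⟩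
    y + (z - y)          ≈⟨ +-comm y (z - y) ⟩
    (z - y) + y          ≈⟨ //-rightDividesˡ y z ⟩
    z                    ∎

  x≈0⇒x*y≈0 : ∀ {x y} → x ≈ 0# → x * y ≈ 0#
  x≈0⇒x*y≈0 {x} {y} x≈0 = ≈-trans (*-congʳ x≈0) (zeroˡ y)

  +-tightˡ : ∀ {x y u v} → x ≤ y → u ≤ v → x + u ≈ y + v → x ≈ y
  +-tightˡ {x} {y} {u} {v} x≤y u≤v x+u≈y+v = +-cancelʳ v x y (antisym x+v≤y+v y+v≤x+v)
    where
    x+v≤y+v = +-mono-≤ v x≤y
    y+v≤x+v = begin
      y + v ≈⟨ x+u≈y+v ⟨
      x + u ≤⟨ +-monoʳ-≤ x u≤v ⟩
      x + v ∎

  ∑ₗ : ∀ {b} {A : Set b} → (A → Carrier) → List A → Carrier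
  ∑ₗ f []       = 0#
  ∑ₗ f (p ∷ ps) = f p + ∑ₗ f ps

  module _ {b} {A : Set b} where

    ∑ₗ-cong : ∀ {f g : A → Carrier} → (∀ p → f p ≈ g p) → ∀ ps → ∑ₗ f ps ≈ ∑ₗ g ps
    ∑ₗ-cong f≈g []       = ≈-refl
    ∑ₗ-cong f≈g (p ∷ ps) = +-cong (f≈g p) (∑ₗ-cong f≈g ps)

    ∑ₗ-distrib-+ : ∀ (f g : A → Carrier) ps → ∑ₗ (λ p → f p + g p) ps ≈ ∑ₗ f ps + ∑ₗ g ps
    ∑ₗ-distrib-+ f g []       = ≈-sym (+-identityˡ 0#)
    ∑ₗ-distrib-+ f g (p ∷ ps) = ≈-trans (+-congˡ (∑ₗ-distrib-+ f g ps)) (interchange (f p) (g p) _ _)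

    *-distribˡ-∑ₗ : ∀ k (f : A → Carrier) ps → k * ∑ₗ f ps ≈ ∑ₗ (λ p → k * f p) ps
    *-distribˡ-∑ₗ k f []       = zeroʳ k
    *-distribˡ-∑ₗ k f (p ∷ ps) = ≈-trans (distribˡ k (f p) (∑ₗ f ps)) (+-congˡ (*-distribˡ-∑ₗ k f ps))

    ∑ₗ-mono-≤ : ∀ {f g : A → Carrier} {ps} → All (λ p → f p ≤ g p) ps → ∑ₗ f ps ≤ ∑ₗ g ps
    ∑ₗ-mono-≤ []           = ≤-refl
    ∑ₗ-mono-≤ (f≤g ∷ f≤gs) = +-mono₂-≤ f≤g (∑ₗ-mono-≤ f≤gs)

    ∑ₗ-tight : ∀ {f g : A → Carrier} {ps} → All (λ p → f p ≤ g p) ps → ∑ₗ f ps ≈ ∑ₗ g ps →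
               All (λ p → f p ≈ g p) ps
    ∑ₗ-tight []           _     = []
    ∑ₗ-tight (f≤g ∷ f≤gs) ∑f≈∑g =
      +-tightˡ f≤g (∑ₗ-mono-≤ f≤gs) ∑f≈∑g
      ∷ ∑ₗ-tight f≤gs (+-tightˡ (∑ₗ-mono-≤ f≤gs) f≤g (≈-trans (+-comm _ _) (≈-trans ∑f≈∑g (+-comm _ _))))

  sumFin≡sum : ∀ {n} (f : Fin n → Carrier) → sumFin f ≡ sum f
  sumFin≡sum {zero}  f = refl
  sumFin≡sum {suc n} f = cong (f Fin.zero +_) (sumFin≡sum (λ v → f (Fin.suc v)))

  sumFin-cong : ∀ {n} {f g : Fin n → Carrier} → (∀ v → f v ≈ g v) → sumFin f ≈ sumFin g
  sumFin-cong {f = f} {g} f≈g rewrite sumFin≡sum f | sumFin≡sum g = sum-cong-≋ f≈g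

  dot-cong : ∀ {n} (c : Fin n → Carrier) {x y} → (∀ v → x v ≈ y v) → dot c x ≈ dot c y
  dot-cong c x≈y = sumFin-cong (λ v → *-congˡ (x≈y v))

  dot-combAt : ∀ {n} (c : Fin n → Carrier) ms →
               dot c (combAt ms) ≈ ∑ₗ (λ p → proj₁ p * dot c (χ (proj₂ p))) ms
  dot-combAt {n} c [] = begin-equality
    dot c (λ (_ : Fin n) → 0#) ≈⟨ sumFin-cong (λ v → zeroʳ (c v)) ⟩
    sumFin {n} (λ _ → 0#)      ≡⟨ sumFin≡sum {n} (λ _ → 0#) ⟩
    sum {n} (λ _ → 0#)         ≈⟨ sum-replicate-zero n ⟩
    0#                         ∎
  dot-combAt {n} c ((μ , S) ∷ ms) = begin-equality
    sumFin (λ v → c v * (μ * χ S v + combAt ms v))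
      ≈⟨ sumFin-cong (λ v → ≈-trans (distribˡ (c v) _ _) (+-congʳ (x∙yz≈y∙xz (c v) μ (χ S v)))) ⟩
    sumFin (λ v → μ * (c v * χ S v) + c v * combAt ms v)
      ≡⟨ sumFin≡sum (λ v → μ * (c v * χ S v) + c v * combAt ms v) ⟩
    sum {n} (λ v → μ * (c v * χ S v) + c v * combAt ms v)
      ≈⟨ ∑-distrib-+ (λ v → μ * (c v * χ S v)) (λ v → c v * combAt ms v) ⟩
    sum {n} (λ v → μ * (c v * χ S v)) + sum (λ v → c v * combAt ms v)
      ≈⟨ +-congʳ (*-distribˡ-sum μ (λ v → c v * χ S v)) ⟨
    μ * sum {n} (λ v → c v * χ S v) + sum (λ v → c v * combAt ms v)
      ≡⟨ cong₂ (λ s s′ → μ * s + s′) (sumFin≡sum (λ v → c v * χ S v)) (sumFin≡sum (λ v → c v * combAt ms v)) ⟨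
    μ * dot c (χ S) + dot c (combAt ms)
      ≈⟨ +-congˡ (dot-combAt c ms) ⟩
    μ * dot c (χ S) + ∑ₗ (λ p → proj₁ p * dot c (χ (proj₂ p))) ms
      ∎

  xW≈dot : ∀ {n} (x : Fin n → Carrier) W → xW x W ≈ dot (χ W) x
  xW≈dot x W = sumFin-cong entry
    where
    entry : ∀ v → (if lookup W v then x v else 0#) ≈ χ W v * x v
    entry v with lookup W v
    ... | true  = ≈-sym (*-identityˡ (x v))
    ... | false = ≈-sym (zeroˡ (x v))

  xW-χ : ∀ {n} (S W : Subset n) → xW (χ S) W ≈ ∣ S ∩ W ∣ times 1#
  xW-χ []          []          = ≈-refl
  xW-χ (true  ∷ S) (true  ∷ W) = +-congˡ (xW-χ S W)
  xW-χ (true  ∷ S) (false ∷ W) = ≈-trans (+-identityˡ _) (xW-χ S W)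
  xW-χ (false ∷ S) (true  ∷ W) = ≈-trans (+-identityˡ _) (xW-χ S W)
  xW-χ (false ∷ S) (false ∷ W) = ≈-trans (+-identityˡ _) (xW-χ S W)

  xW-χ≈0 : ∀ {n} {S W : Subset n} → ∣ S ∩ W ∣ ≡ 0 → xW (χ S) W ≈ 0#
  xW-χ≈0 {S = S} {W} ∣S∩W∣≡0 = ≈-trans (xW-χ S W) (≈-reflexive (cong (_times 1#) ∣S∩W∣≡0))

  xW-χ≈1 : ∀ {n} {S W : Subset n} → ∣ S ∩ W ∣ ≡ 1 → xW (χ S) W ≈ 1#
  xW-χ≈1 {S = S} {W} ∣S∩W∣≡1 =
    ≈-trans (xW-χ S W) (≈-trans (≈-reflexive (cong (_times 1#) ∣S∩W∣≡1)) (+-identityʳ 1#))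

  χ∈STAB : ∀ {n} {H : Graph n} {S} → IsStable H S → STAB H (χ S)
  χ∈STAB {S = S} stable =
    (1# , S) ∷ [] , (0≤1 , stable) ∷ [] , +-identityʳ 1# , λ v → ≈-sym (≈-trans (+-identityʳ _) (*-identityˡ _))

  sumCoeff≡∑ₗ : ∀ {n} (ms : List (Carrier × Subset n)) → sumCoeff ms ≡ ∑ₗ proj₁ ms
  sumCoeff≡∑ₗ []       = refl
  sumCoeff≡∑ₗ (m ∷ ms) = cong (proj₁ m +_) (sumCoeff≡∑ₗ ms)

  record Affine {n} (F : (Fin n → Carrier) → Carrier) : Set (a ⊔ ℓ₁) where
    field
      respects-≈  : ∀ {x y} → (∀ v → x v ≈ y v) → F x ≈ F y
      combination : ∀ ms → sumCoeff ms ≈ 1# →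
                    F (combAt ms) ≈ ∑ₗ (λ p → proj₁ p * F (χ (proj₂ p))) ms

  open Affine

  affine-const : ∀ {n} k → Affine {n} (λ _ → k)
  affine-const k .respects-≈ _ = ≈-refl
  affine-const k .combination ms ∑μ≈1 = begin-equality
    k                          ≈⟨ *-identityˡ k ⟨
    1# * k                     ≈⟨ *-congʳ ∑μ≈1 ⟨
    sumCoeff ms * k            ≡⟨ cong (_* k) (sumCoeff≡∑ₗ ms) ⟩
    ∑ₗ proj₁ ms * k            ≈⟨ *-comm _ k ⟩
    k * ∑ₗ proj₁ ms            ≈⟨ *-distribˡ-∑ₗ k proj₁ ms ⟩
    ∑ₗ (λ p → k * proj₁ p) ms  ≈⟨ ∑ₗ-cong (λ p → *-comm k (proj₁ p)) ms ⟩
    ∑ₗ (λ p → proj₁ p * k) ms  ∎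

  affine-+ : ∀ {n} {F G : (Fin n → Carrier) → Carrier} → Affine F → Affine G → Affine (λ x → F x + G x)
  affine-+ F G .respects-≈ x≈y = +-cong (F .respects-≈ x≈y) (G .respects-≈ x≈y)
  affine-+ {F = f} {g} F G .combination ms ∑μ≈1 = begin-equality
    f (combAt ms) + g (combAt ms)
      ≈⟨ +-cong (F .combination ms ∑μ≈1) (G .combination ms ∑μ≈1) ⟩
    ∑ₗ (λ p → proj₁ p * f (χ (proj₂ p))) ms + ∑ₗ (λ p → proj₁ p * g (χ (proj₂ p))) ms
      ≈⟨ ∑ₗ-distrib-+ _ _ ms ⟨
    ∑ₗ (λ p → proj₁ p * f (χ (proj₂ p)) + proj₁ p * g (χ (proj₂ p))) ms
      ≈⟨ ∑ₗ-cong (λ p → distribˡ (proj₁ p) _ _) ms ⟨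
    ∑ₗ (λ p → proj₁ p * (f (χ (proj₂ p)) + g (χ (proj₂ p)))) ms
      ∎

  affine-*ˡ : ∀ {n} k {F : (Fin n → Carrier) → Carrier} → Affine F → Affine (λ x → k * F x)
  affine-*ˡ k F .respects-≈ x≈y = *-congˡ (F .respects-≈ x≈y)
  affine-*ˡ k {f} F .combination ms ∑μ≈1 = begin-equality
    k * f (combAt ms)                                ≈⟨ *-congˡ (F .combination ms ∑μ≈1) ⟩
    k * ∑ₗ (λ p → proj₁ p * f (χ (proj₂ p))) ms      ≈⟨ *-distribˡ-∑ₗ k _ ms ⟩
    ∑ₗ (λ p → k * (proj₁ p * f (χ (proj₂ p)))) ms    ≈⟨ ∑ₗ-cong (λ p → x∙yz≈y∙xz k (proj₁ p) _) ms ⟩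
    ∑ₗ (λ p → proj₁ p * (k * f (χ (proj₂ p)))) ms    ∎

  affine-dot : ∀ {n} (c : Fin n → Carrier) → Affine (dot c)
  affine-dot c .respects-≈ = dot-cong c
  affine-dot c .combination ms _ = dot-combAt c ms

  affine-xW : ∀ {n} (W : Subset n) → Affine (λ x → xW x W)
  affine-xW W .respects-≈ {x} {y} x≈y = begin-equality
    xW x W       ≈⟨ xW≈dot x W ⟩
    dot (χ W) x  ≈⟨ dot-cong (χ W) x≈y ⟩
    dot (χ W) y  ≈⟨ xW≈dot y W ⟨
    xW y W       ∎
  affine-xW W .combination ms _ = begin-equality
    xW (combAt ms) W                                     ≈⟨ xW≈dot (combAt ms) W ⟩
    dot (χ W) (combAt ms)                                ≈⟨ dot-combAt (χ W) ms ⟩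
    ∑ₗ (λ p → proj₁ p * dot (χ W) (χ (proj₂ p))) ms
      ≈⟨ ∑ₗ-cong (λ p → *-congˡ (xW≈dot (χ (proj₂ p)) W)) ms ⟨
    ∑ₗ (λ p → proj₁ p * xW (χ (proj₂ p)) W) ms           ∎

  affine-sumN : ∀ {n} k {F : ℕ → (Fin n → Carrier) → Carrier} → (∀ i → Affine (F i)) →
                Affine (λ x → sumN k (λ i → F i x))
  affine-sumN zero    F = affine-const 0#
  affine-sumN (suc k) F = affine-+ (affine-sumN k F) (F k)

  affine-fval : ∀ {n} (W : ℕ → Subset n) r c λS t → Affine (fval W r c λS t)
  affine-fval W r c λS t =
    affine-+ (affine-dot c) (affine-sumN (r ∸ t) λ i →
      affine-*ˡ (λS (t +ℕ suc i)) (affine-+ (affine-xW (W (t +ℕ suc i))) (affine-const (- 1#))))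

  affine-≤-on-support : ∀ {n} {F : (Fin n → Carrier) → Carrier} {x d} → Affine F →
    ∀ ms → All (λ p → 0# ≤ proj₁ p) ms → sumCoeff ms ≈ 1# → (∀ v → x v ≈ combAt ms v) →
    All (λ p → proj₁ p ≈ 0# ⊎ F (χ (proj₂ p)) ≤ d) ms → F x ≤ d
  affine-≤-on-support {F = f} {x} {d} F ms nonneg ∑μ≈1 x≈ms bounded = begin
    f x                                        ≈⟨ F .respects-≈ x≈ms ⟩
    f (combAt ms)                              ≈⟨ F .combination ms ∑μ≈1 ⟩
    ∑ₗ (λ p → proj₁ p * f (χ (proj₂ p))) ms    ≤⟨ ∑ₗ-mono-≤ (All.zipWith (λ {p} → weighted {p}) (nonneg , bounded)) ⟩
    ∑ₗ (λ p → proj₁ p * d) ms                  ≈⟨ affine-const d .combination ms ∑μ≈1 ⟨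
    d                                          ∎
    where
    weighted : ∀ {p} → (0# ≤ proj₁ p) × (proj₁ p ≈ 0# ⊎ f (χ (proj₂ p)) ≤ d) →
               proj₁ p * f (χ (proj₂ p)) ≤ proj₁ p * d
    weighted (_   , inj₁ μ≈0)  = ≤-reflexive (≈-trans (x≈0⇒x*y≈0 μ≈0) (≈-sym (x≈0⇒x*y≈0 μ≈0)))
    weighted (0≤μ , inj₂ fS≤d) = *-monoˡ-≤-nonneg 0≤μ fS≤d

  IsMaxOr0-upper : ∀ {n p} {P : Subset n → Set p} {g m} → IsMaxOr0 P g m → ∀ {b} → P b → g b ≤ m
  IsMaxOr0-upper (inj₁ (_ , upper)) Pb = upper _ Pb
  IsMaxOr0-upper (inj₂ (empty , _)) Pb = contradiction Pb (empty _)

  sumN-cong : ∀ k {g h : ℕ → Carrier} → (∀ i → g i ≈ h i) → sumN k g ≈ sumN k h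
  sumN-cong zero    g≈h = ≈-refl
  sumN-cong (suc k) g≈h = +-cong (sumN-cong k g≈h) (g≈h k)

  sumN-unfoldˡ : ∀ k (g : ℕ → Carrier) → sumN (suc k) g ≈ g 0 + sumN k (λ i → g (suc i))
  sumN-unfoldˡ zero    g = ≈-trans (+-identityˡ (g 0)) (≈-sym (+-identityʳ (g 0)))
  sumN-unfoldˡ (suc k) g = ≈-trans (+-congʳ (sumN-unfoldˡ k g)) (+-assoc _ _ _)

  sumRange-empty : ∀ t (g : ℕ → Carrier) → sumRange t t g ≈ 0#
  sumRange-empty t g rewrite ℕ.n∸n≡0 t = ≈-refl

  sumRange-unfold : ∀ {k t r} (g : ℕ → Carrier) → suc k +ℕ t ≡ r →
                    sumRange t r g ≈ g (suc t) + sumRange (suc t) r g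
  sumRange-unfold {k} {t} g refl rewrite ℕ.m+n∸n≡m (suc k) t | ℕ.m+n∸n≡m k t = begin-equality
    sumN (suc k) (λ i → g (t +ℕ suc i))                     ≈⟨ sumN-unfoldˡ k (λ i → g (t +ℕ suc i)) ⟩
    g (t +ℕ 1) + sumN k (λ i → g (t +ℕ suc (suc i)))
      ≈⟨ +-cong (≈-reflexive (cong g (ℕ.+-comm t 1)))
                (sumN-cong k (λ i → ≈-reflexive (cong g (ℕ.+-suc t (suc i))))) ⟩
    g (suc t) + sumN k (λ i → g (suc t +ℕ suc i))           ∎

  module Validity {n} {G : Graph n} {r : ℕ} {W : ℕ → Subset n}
    (cliques : ∀ t → 1 ≤ℕ t → t ≤ℕ r → IsClique (Gseq G W (t ∸ 1)) (W t))
    {c : Fin n → Carrier} {d : Carrier}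
    (valid : ∀ x → STAB (Gseq G W r) x → dot c x ≤ d)
    {λS : ℕ → Carrier}
    (maximal : ∀ ℓ → 1 ≤ℕ ℓ → ℓ ≤ℕ r →
      IsMaxOr0 (λ b → Sset G W (ℓ ∸ 1) b × (xW (χ b) (W ℓ) ≈ 0#))
               (λ b → fval W r c λS ℓ (χ b) - d)
               (λS ℓ))
    where

    f : ℕ → (Fin n → Carrier) → Carrier
    f = fval W r c λS

    penalty : (Fin n → Carrier) → ℕ → Carrier
    penalty x ℓ = λS ℓ * (xW x (W ℓ) - 1#)

    f-last : ∀ {t} x → t ≡ r → f t x ≈ dot c x
    f-last {t} x refl = ≈-trans (+-congˡ (sumRange-empty t (penalty x))) (+-identityʳ (dot c x))

    f-unfold : ∀ {k t} x → suc k +ℕ t ≡ r → f t x ≈ f (suc t) x + penalty x (suc t)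
    f-unfold x 1+k+t≡r = ≈-trans (+-congˡ (sumRange-unfold (penalty x) 1+k+t≡r)) (x∙yz≈xz∙y _ _ _)

    meets-next-0⊎1 : ∀ {t S} → t <ℕ r → IsStable (Gseq G W t) S →
                     ∣ S ∩ W (suc t) ∣ ≡ 0 ⊎ ∣ S ∩ W (suc t) ∣ ≡ 1
    meets-next-0⊎1 {t} t<r stable = ℕ.n≤1⇒n≡0∨n≡1 (∣stable∩clique∣≤1 stable (cliques (suc t) (s≤s z≤n) t<r))

    χ∈Sset : ∀ {t S} → IsStable G S → MeetsOnce W t S → Sset G W t S
    χ∈Sset {S = S} stable meets = χ∈STAB stable , λ j 1≤j j≤t → xW-χ≈1 {S = S} {W j} (meets j 1≤j j≤t)

    f≤d-on-Sset : ∀ k {t S} → k +ℕ t ≡ r → IsStable G S → MeetsOnce W t S → f t (χ S) ≤ d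
    f≤d-on-Sset zero {t} {S} refl stable meets = begin
      f t (χ S)    ≈⟨ f-last (χ S) refl ⟩
      dot c (χ S)  ≤⟨ valid (χ S) (χ∈STAB (stable-Gseq {W = W} t stable meets)) ⟩
      d            ∎
    f≤d-on-Sset (suc k) {t} {S} 1+k+t≡r stable meets
      with meets-next-0⊎1 (1+k+t≡r⇒t<r 1+k+t≡r) (stable-Gseq {W = W} t stable meets)
    ... | inj₂ meets-next = begin
      f t (χ S)                                 ≈⟨ f-unfold (χ S) 1+k+t≡r ⟩
      f (suc t) (χ S) + penalty (χ S) (suc t)   ≈⟨ +-congˡ vanishes ⟩
      f (suc t) (χ S) + 0#                      ≈⟨ +-identityʳ _ ⟩
      f (suc t) (χ S)                           ≤⟨ f≤d-on-Sset k k+[1+t]≡r stable meets′ ⟩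
      d                                         ∎
      where
      k+[1+t]≡r : k +ℕ suc t ≡ r
      k+[1+t]≡r = trans (ℕ.+-suc k t) 1+k+t≡r
      meets′ = MeetsOnce-suc {S = S} meets meets-next
      vanishes : penalty (χ S) (suc t) ≈ 0#
      vanishes = ≈-trans (*-congˡ (≈-trans (+-congʳ (xW-χ≈1 {S = S} meets-next)) (-‿inverseʳ 1#))) (zeroʳ _)
    ... | inj₁ misses-next = begin
      f t (χ S)                                 ≈⟨ f-unfold (χ S) 1+k+t≡r ⟩
      f (suc t) (χ S) + penalty (χ S) (suc t)   ≈⟨ +-congˡ subtracts ⟩
      f (suc t) (χ S) - λS (suc t)              ≤⟨ x-z≤y⇒x-y≤z (IsMaxOr0-upper maximum {S} (χ∈Sset stable meets , misses)) ⟩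
      d                                         ∎
      where
      maximum = maximal (suc t) (s≤s z≤n) (1+k+t≡r⇒t<r 1+k+t≡r)
      misses : xW (χ S) (W (suc t)) ≈ 0#
      misses = xW-χ≈0 {S = S} misses-next
      subtracts : penalty (χ S) (suc t) ≈ - λS (suc t)
      subtracts = begin-equality
        λS (suc t) * (xW (χ S) (W (suc t)) - 1#)  ≈⟨ *-congˡ (≈-trans (+-congʳ misses) (+-identityˡ _)) ⟩
        λS (suc t) * - 1#                         ≈⟨ -‿distribʳ-* (λS (suc t)) 1# ⟨
        - (λS (suc t) * 1#)                       ≈⟨ -‿cong (*-identityʳ _) ⟩
        - λS (suc t)                              ∎

    Admissible : ℕ → Carrier × Subset n → Set ℓ₁
    Admissible j (μ , S) = μ ≈ 0# ⊎ MeetsOnce W j S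

    admissible-step : ∀ {j μ S} → j <ℕ r → 0# ≤ μ → IsStable G S → Admissible j (μ , S) →
                      (μ * xW (χ S) (W (suc j)) ≤ μ)
                      × (μ * xW (χ S) (W (suc j)) ≈ μ → Admissible (suc j) (μ , S))
    admissible-step _ _ _ (inj₁ μ≈0) = ≤-reflexive (≈-trans (x≈0⇒x*y≈0 μ≈0) (≈-sym μ≈0)) , λ _ → inj₁ μ≈0
    admissible-step {j} {μ} {S} j<r 0≤μ stable (inj₂ meets)
      with meets-next-0⊎1 j<r (stable-Gseq {W = W} j stable meets)
    ... | inj₁ misses-next = ≤-trans (≤-reflexive μxW≈0) 0≤μ , λ μxW≈μ → inj₁ (≈-trans (≈-sym μxW≈μ) μxW≈0)
      where
      μxW≈0 : μ * xW (χ S) (W (suc j)) ≈ 0#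
      μxW≈0 = ≈-trans (*-congˡ (xW-χ≈0 {S = S} misses-next)) (zeroʳ μ)
    ... | inj₂ meets-next = ≤-reflexive (≈-trans (*-congˡ (xW-χ≈1 {S = S} meets-next)) (*-identityʳ μ))
                          , λ _ → inj₂ (MeetsOnce-suc {S = S} meets meets-next)

    module _ {t x} (t≤r : t ≤ℕ r) (onFace : ∀ j → 1 ≤ℕ j → j ≤ℕ t → xW x (W j) ≈ 1#)
             {ms} (nonneg-stable : All (λ p → (0# ≤ proj₁ p) × IsStable G (proj₂ p)) ms)
             (∑μ≈1 : sumCoeff ms ≈ 1#) (x≈ms : ∀ v → x v ≈ combAt ms v) where

      support-admissible : ∀ j → j ≤ℕ t → All (Admissible j) ms
      support-admissible zero _ = All.map (λ {p} _ → inj₂ (MeetsOnce-zero W (proj₂ p))) nonneg-stable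
      support-admissible (suc j) 1+j≤t =
        All.zipWith (λ (step , tight) → proj₂ step tight) (steps , ∑ₗ-tight (All.map proj₁ steps) ∑μxW≈∑μ)
        where
        W′ = W (suc j)
        steps = All.zipWith (λ ((0≤μ , stable) , admissible) → admissible-step j<r 0≤μ stable admissible)
                  (nonneg-stable , support-admissible j (ℕ.<⇒≤ 1+j≤t))
          where j<r = ℕ.≤-trans 1+j≤t t≤r
        ∑μxW≈∑μ : ∑ₗ (λ p → proj₁ p * xW (χ (proj₂ p)) W′) ms ≈ ∑ₗ proj₁ ms
        ∑μxW≈∑μ = begin-equality
          ∑ₗ (λ p → proj₁ p * xW (χ (proj₂ p)) W′) ms   ≈⟨ affine-xW W′ .combination ms ∑μ≈1 ⟨
          xW (combAt ms) W′                             ≈⟨ affine-xW W′ .respects-≈ x≈ms ⟨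
          xW x W′                                       ≈⟨ onFace (suc j) (s≤s z≤n) 1+j≤t ⟩
          1#                                            ≈⟨ ∑μ≈1 ⟨
          sumCoeff ms                                   ≡⟨ sumCoeff≡∑ₗ ms ⟩
          ∑ₗ proj₁ ms                                   ∎

    f≤d-on-Fset : ∀ {t} → t ≤ℕ r → ∀ x → Fset G W t x → f t x ≤ d
    f≤d-on-Fset {t} t≤r x ((ms , nonneg-stable , ∑μ≈1 , x≈ms) , onFace) =
      affine-≤-on-support (affine-fval W r c λS t) ms (All.map proj₁ nonneg-stable) ∑μ≈1 x≈ms
        (All.zipWith bounded (nonneg-stable , support-admissible t≤r onFace nonneg-stable ∑μ≈1 x≈ms t ℕ.≤-refl))
      where
      bounded : ∀ {p} → ((0# ≤ proj₁ p) × IsStable G (proj₂ p)) × Admissible t p →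
                proj₁ p ≈ 0# ⊎ f t (χ (proj₂ p)) ≤ d
      bounded (_            , inj₁ μ≈0)  = inj₁ μ≈0
      bounded ((_ , stable) , inj₂ meets) = inj₂ (f≤d-on-Sset (r ∸ t) (ℕ.m∸n+n≡m t≤r) stable meets)

lemma6 : ∀ {a ℓ₁ ℓ₂} (K : OrderedField a ℓ₁ ℓ₂) → let open OF K in
    (n : ℕ) (G : Graph n) → Simple G →
    (r : ℕ) (W : ℕ → Subset n) →
    (∀ i j → 1 ≤ℕ i → i ≤ℕ r → 1 ≤ℕ j → j ≤ℕ r → i ≢ j → W i ≢ W j) →
    (∀ t → 1 ≤ℕ t → t ≤ℕ r → IsClique (Gseq G W (t ∸ 1)) (W t) × (2 ≤ℕ ∣ W t ∣)) →
    (c : Fin n → Carrier) (d : Carrier) →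
    (∀ x → STAB (Gseq G W r) x → dot c x ≤ d) →
    (λS : ℕ → Carrier) →
    (∀ ℓ → 1 ≤ℕ ℓ → ℓ ≤ℕ r →
      IsMaxOr0 (λ b → Sset G W (ℓ ∸ 1) b × (xW (χ b) (W ℓ) ≈ 0#))
               (λ b → fval W r c λS ℓ (χ b) - d)
               (λS ℓ)) →
    ∀ t → t ≤ℕ r → ∀ x → Fset G W t x → fval W r c λS t x ≤ d
lemma6 K n G _ r W _ cliques c d valid λS maximal t t≤r =
  Validity.f≤d-on-Fset K (λ ℓ 1≤ℓ ℓ≤r → proj₁ (cliques ℓ 1≤ℓ ℓ≤r)) valid maximal t≤r
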